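{- Let $G$ be an undirected simple graph, $k$ a positive integer and $\mathit{In}\neq\emptyset$ an edge set with $G[\mathit{In}]$ connected, such that the instance $(G,\mathit{In},k)$ is trimmed, and let $E_{\mathrm{far}}$ be its set of far edges. Then the graph returned by $\mathrm{TRIM}(G-E_{\mathrm{far}},\mathit{In},k)$ has at least $|E(G)|-|E_{\mathrm{far}}|$ edges.
   Context: $G[F]$ is the subgraph with edge set $F$ and vertex set the endpoints of $F$; $V_{\mathit{In}}$ is the vertex set of $G[\mathit{In}]$. For a vertex set $X$ and edge $e=\{u,v\}$, $\mathrm{dist}(X,e)$ is the minimum over $w\in\{u,v\}$ of the distance from $w$ to the nearest vertex of $X$ (in the graph under consideration). An edge $e$ is unnecessary if $\mathrm{dist}(V_{\mathit{In}},e)\ge k-|\mathit{In}|$; it is far if $\mathrm{dist}(V_{\mathit{In}},e)=k-|\mathit{In}|-1$. The instance $(G,\mathit{In},k)$ is trimmed if $G$ has no unnecessary edges. An edge $e$ is mandatory if the connected component of the graph minus $e$ containing $V_{\mathit{In}}$ has fewer than $k$ edges. $\mathrm{TRIM}(G,\mathit{In},k)$ removes all unnecessary edges from $G$ (giving $H$), then iteratively adds to $\mathit{In}$ mandatory edges of $H$ incident to $V_{\mathit{In}}$; it returns $H$ and the enlarged $\mathit{In}$. -}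

module Defs where

open import Data.Nat using (ℕ; zero; suc; _≤_; _<_; _∸_)
open import Data.Fin as Fin using (Fin)
import Data.Fin.Properties as FinP
open import Data.Product using (Σ; ∃; _×_; _,_; proj₁; proj₂)
open import Data.Product.Properties using (≡-dec)
open import Data.Sum using (_⊎_)
open import Data.List using (List; []; _∷_; length; filter)
open import Data.List.Relation.Unary.All using (All)
open import Data.List.Relation.Unary.Unique.Propositional using (Unique)
open import Data.List.Membership.Propositional using (_∈_; _∉_)
import Data.List.Membership.DecPropositional as DecMem
open import Relation.Nullary using (¬_; ¬?)
open import Relation.Binary.PropositionalEquality using (_≡_)
open import Function.Bundles using (_⇔_)

-- An edge {u,v} on vertex set Fin n is stored canonically as (u , v) with u < v.
Edge : ℕ → Set
Edge n = Fin n × Fin n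

SimpleGraph : ∀ {n} → List (Edge n) → Set
SimpleGraph E = All (λ e → proj₁ e Fin.< proj₂ e) E × Unique E

IsEdgeSetOf : ∀ {n} → List (Edge n) → (Edge n → Set) → Set
IsEdgeSetOf L P = Unique L × (∀ e → (e ∈ L) ⇔ P e)

_⊆E_ : ∀ {n} → List (Edge n) → List (Edge n) → Set
F ⊆E E = ∀ {e} → e ∈ F → e ∈ E

Adj : ∀ {n} → List (Edge n) → Fin n → Fin n → Set
Adj E u v = ((u , v) ∈ E) ⊎ ((v , u) ∈ E)

data Walk {n} (E : List (Edge n)) : Fin n → Fin n → ℕ → Set where
  here : ∀ {u} → Walk E u u zero
  step : ∀ {u v w m} → Adj E u v → Walk E v w m → Walk E u w (suc m)

VIn : ∀ {n} → List (Edge n) → Fin n → Set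
VIn F w = ∃ λ e → e ∈ F × (w ≡ proj₁ e ⊎ w ≡ proj₂ e)

ConnectedSub : ∀ {n} → List (Edge n) → Set
ConnectedSub F = ∀ u v → VIn F u → VIn F v → ∃ λ j → Walk F u v j

-- dist_E(X, w) ≥ d  (distance from w to nearest vertex of X; ∞ if none reachable)
VDistGE : ∀ {n} → List (Edge n) → (Fin n → Set) → Fin n → ℕ → Set
VDistGE E X w d = ∀ x → X x → ∀ j → j < d → ¬ Walk E w x j

-- dist_E(X, e) ≥ d, where dist(X,{u,v}) = min over the two endpoints.
EDistGE : ∀ {n} → List (Edge n) → (Fin n → Set) → Edge n → ℕ → Set
EDistGE E X e d = VDistGE E X (proj₁ e) d × VDistGE E X (proj₂ e) d

EDistEq : ∀ {n} → List (Edge n) → (Fin n → Set) → Edge n → ℕ → Set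
EDistEq E X e d = EDistGE E X e d × ¬ EDistGE E X e (suc d)

Unnecessary : ∀ {n} → List (Edge n) → List (Edge n) → ℕ → Edge n → Set
Unnecessary E In k e = EDistGE E (VIn In) e (k ∸ length In)

Far : ∀ {n} → List (Edge n) → List (Edge n) → ℕ → Edge n → Set
Far E In k e = EDistEq E (VIn In) e (k ∸ length In ∸ 1)

Trimmed : ∀ {n} → List (Edge n) → List (Edge n) → ℕ → Set
Trimmed E In k = ∀ e → e ∈ E → ¬ Unnecessary E In k e

_─E_ : ∀ {n} → List (Edge n) → List (Edge n) → List (Edge n)
_─E_ {n} E F = filter (λ e → ¬? (e ∈? F)) E
  where open DecMem (≡-dec FinP._≟_ FinP._≟_) using (_∈?_)

-- The graph H returned by TRIM(G, In, k): the edges of G that are not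
-- unnecessary (the second phase of TRIM only enlarges In, not the graph).
TrimGraph : ∀ {n} → List (Edge n) → List (Edge n) → ℕ → List (Edge n) → Set
TrimGraph E In k H = IsEdgeSetOf H (λ e → e ∈ E × ¬ Unnecessary E In k e)

-- Write d = k − |In|. A walk to V_In of length below d − 1 only uses edges at distance
-- below d − 1 from V_In, and these are not far; so deleting the far edges lifts no
-- distance from below d − 1 to d. An edge that became unnecessary in G − E_far would
-- therefore have distance at least d − 1 in G, and, G being trimmed, exactly d − 1:
-- it would be far. Hence TRIM deletes nothing from G − E_far, and |E_far| edges
-- account for all that was lost.
module Submission where

open import Defs
open import Data.Nat using (ℕ; suc; _≤_; _<_; _∸_; _+_; z≤n; s≤s)
open import Data.Nat.Properties using (≤-trans; <-≤-trans; <⇒≤; m∸n≤m; m≤n+m∸n; m≤n+o⇒m∸n≤o)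
open import Data.List using (List; []; _∷_; _++_; length)
open import Data.List.Properties using (length-++)
open import Data.List.Relation.Unary.All as All using ()
open import Data.List.Relation.Unary.AllPairs using (_∷_)
open import Data.List.Relation.Unary.Any using (here; there)
open import Data.List.Relation.Unary.Unique.Propositional using (Unique)
import Data.List.Relation.Unary.Unique.Propositional.Properties as Unique
open import Data.List.Relation.Binary.Permutation.Propositional.Properties using (↭-length; shift)
open import Data.List.Membership.Propositional using (_∈_; _∉_)
open import Data.List.Membership.Propositional.Properties
  using (∈-∃++; ∈-++⁺ˡ; ∈-++⁺ʳ; ∈-++⁻; ∈-filter⁺; ∈-filter⁻)
import Data.List.Membership.DecPropositional as DecMem
open import Data.Fin using (Fin)
import Data.Fin.Properties as FinP
open import Data.Product using (_×_; _,_; proj₁; proj₂)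
open import Data.Product.Properties using (≡-dec)
open import Data.Sum using (inj₁; inj₂)
open import Data.Empty using (⊥-elim)
open import Relation.Nullary using (¬_; ¬?; yes; no)
open import Relation.Binary.PropositionalEquality using (_≡_; _≢_; refl; sym; subst)
open import Function.Bundles using (Equivalence)

private
  variable
    A : Set
    n : ℕ

∈-++-∷⁻ : ∀ {x y : A} as bs → y ∈ as ++ x ∷ bs → y ≢ x → y ∈ as ++ bs
∈-++-∷⁻ as bs y∈ y≢x with ∈-++⁻ as y∈
... | inj₁ y∈as         = ∈-++⁺ˡ y∈as
... | inj₂ (here y≡x)   = ⊥-elim (y≢x y≡x)
... | inj₂ (there y∈bs) = ∈-++⁺ʳ as y∈bs

Unique⇒length≤ : ∀ {xs ys : List A} → Unique xs → (∀ {y} → y ∈ xs → y ∈ ys) → length xs ≤ length ys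
Unique⇒length≤ {xs = []}     _          _   = z≤n
Unique⇒length≤ {xs = x ∷ xs} (x∉ ∷ uxs) sub with ∈-∃++ (sub (here refl))
... | as , bs , refl =
  subst (suc (length xs) ≤_) (sym (↭-length (shift x as bs)))
    (s≤s (Unique⇒length≤ uxs (λ y∈ → ∈-++-∷⁻ as bs (sub (there y∈)) (λ y≡x → All.lookup x∉ y∈ (sym y≡x)))))

module _ {n} {F : List (Edge n)} where
  open DecMem (≡-dec (FinP._≟_ {n}) (FinP._≟_ {n})) using (_∈?_)

  ∈-─E⁺ : ∀ {E e} → e ∈ E → e ∉ F → e ∈ E ─E F
  ∈-─E⁺ = ∈-filter⁺ (λ e → ¬? (e ∈? F))

  ∈-─E⁻ : ∀ {E e} → e ∈ E ─E F → e ∈ E × e ∉ F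
  ∈-─E⁻ {E} = ∈-filter⁻ (λ e → ¬? (e ∈? F)) {xs = E}

  Unique-─E : ∀ {E} → Unique E → Unique (E ─E F)
  Unique-─E = Unique.filter⁺ (λ e → ¬? (e ∈? F))

  length≤length+length-─E : ∀ {E} → Unique E → length E ≤ length F + length (E ─E F)
  length≤length+length-─E {E} uE =
    subst (length E ≤_) (length-++ F) (Unique⇒length≤ uE split)
    where
    split : ∀ {e} → e ∈ E → e ∈ F ++ (E ─E F)
    split {e} e∈E with e ∈? F
    ... | yes e∈F = ∈-++⁺ˡ e∈F
    ... | no  e∉F = ∈-++⁺ʳ F (∈-─E⁺ e∈E e∉F)

module _ {n} {E : List (Edge n)} {X : Fin n → Set} where

  EDistGE-antitone : ∀ {e m d} → m ≤ d → EDistGE E X e d → EDistGE E X e m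
  EDistGE-antitone m≤d (D₁ , D₂) =
    (λ x Xx j j<m → D₁ x Xx j (<-≤-trans j<m m≤d)) , (λ x Xx j j<m → D₂ x Xx j (<-≤-trans j<m m≤d))

  module _ {E′ : List (Edge n)} {m : ℕ} (keep : ∀ {e} → e ∈ E → ¬ EDistGE E X e m → e ∈ E′) where

    Walk-restrict : ∀ {u x j} → X x → Walk E u x j → j < m → Walk E′ u x j
    Walk-restrict Xx here                 _  = here
    Walk-restrict Xx (step (inj₁ uv∈) w) sj<m =
      step (inj₁ (keep uv∈ (λ D → proj₂ D _ Xx _ (<⇒≤ sj<m) w))) (Walk-restrict Xx w (<⇒≤ sj<m))
    Walk-restrict Xx (step (inj₂ vu∈) w) sj<m =
      step (inj₂ (keep vu∈ (λ D → proj₁ D _ Xx _ (<⇒≤ sj<m) w))) (Walk-restrict Xx w (<⇒≤ sj<m))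

    EDistGE-restrict : ∀ {e} → EDistGE E′ X e m → EDistGE E X e m
    EDistGE-restrict (D₁ , D₂) =
      (λ x Xx j j<m w → D₁ x Xx j j<m (Walk-restrict Xx w j<m)) ,
      (λ x Xx j j<m w → D₂ x Xx j j<m (Walk-restrict Xx w j<m))

module _ {n} {G In : List (Edge n)} {k : ℕ} (trimmed : Trimmed G In k) where

  Trimmed⇒Far : ∀ {e} → e ∈ G → EDistGE G (VIn In) e (k ∸ length In ∸ 1) → Far G In k e
  Trimmed⇒Far e∈G D = D , λ D′ → trimmed _ e∈G (EDistGE-antitone (m≤n+m∸n (k ∸ length In) 1) D′)

  Trimmed-─E-far : ∀ {Efar} → IsEdgeSetOf Efar (λ e → e ∈ G × Far G In k e) → Trimmed (G ─E Efar) In k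
  Trimmed-─E-far {Efar} (_ , Efar⇔far) e e∈G′ unnecessary =
    e∉Efar (Equivalence.from (Efar⇔far e) (e∈G , Trimmed⇒Far e∈G
      (EDistGE-restrict close-kept (EDistGE-antitone (m∸n≤m (k ∸ length In) 1) unnecessary))))
    where
    e∈G = proj₁ (∈-─E⁻ {E = G} e∈G′)
    e∉Efar = proj₂ (∈-─E⁻ {E = G} e∈G′)
    close-kept : ∀ {f} → f ∈ G → ¬ EDistGE G (VIn In) f (k ∸ length In ∸ 1) → f ∈ G ─E Efar
    close-kept f∈G ¬D = ∈-─E⁺ f∈G (λ f∈Efar → ¬D (proj₁ (proj₂ (Equivalence.to (Efar⇔far _) f∈Efar))))

TrimGraph-⊇ : ∀ {E In : List (Edge n)} {k H} → Trimmed E In k → TrimGraph E In k H → E ⊆E H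
TrimGraph-⊇ trimmed (_ , H⇔) {e} e∈E = Equivalence.from (H⇔ e) (e∈E , trimmed e e∈E)

lemma8 : ∀ {n} (G In : List (Edge n)) (k : ℕ)
         → SimpleGraph G → 1 ≤ k
         → ¬ (In ≡ []) → Unique In → In ⊆E G → ConnectedSub In
         → Trimmed G In k
         → (Efar : List (Edge n)) → IsEdgeSetOf Efar (λ e → e ∈ G × Far G In k e)
         → (H : List (Edge n)) → TrimGraph (G ─E Efar) In k H
         → length G ∸ length Efar ≤ length H
lemma8 G In k (_ , uniqueG) _ _ _ _ _ trimmed Efar Efar-far H H-trim =
  ≤-trans (m≤n+o⇒m∸n≤o (length G) (length Efar) (length≤length+length-─E uniqueG))
          (Unique⇒length≤ (Unique-─E uniqueG) (TrimGraph-⊇ (Trimmed-─E-far trimmed Efar-far) H-trim))
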